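{- Let $A$ and $B$ be two disjoint bases of a matroid $M$. For any $A_1\subset A$ with $|A_1|=2$ there exists $B_1\subset B$ with $|B_1|=2$ such that $A_1$ and $B_1$ form a serial symmetric exchange relative to $A$ and $B$; that is, one can write $A_1=\{a_1,a_2\}$ and $B_1=\{b_1,b_2\}$ so that $A-a_1+b_1$, $B-b_1+a_1$, $(A\setminus\{a_1,a_2\})\cup\{b_1,b_2\}$ and $(B\setminus\{b_1,b_2\})\cup\{a_1,a_2\}$ are all bases of $M$.
   Context: Notation: $X+x=X\cup\{x\}$, $X-x=X\setminus\{x\}$. For disjoint bases $A,B$ and $X\subseteq A$, $Y\subseteq B$ with $|X|=|Y|=k$, $(X,Y)$ is a serial symmetric exchange relative to $A$ and $B$ if there are orderings $X=\{a_1\prec\cdots\prec a_k\}$, $Y=\{b_1\prec\cdots\prec b_k\}$ such that for each $i=1,\dots,k$ both $(A\setminus\{a_1,\dots,a_i\})\cup\{b_1,\dots,b_i\}$ and $(B\setminus\{b_1,\dots,b_i\})\cup\{a_1,\dots,a_i\}$ are bases. -}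

module Defs where

open import Data.Nat using (ℕ)
open import Data.Fin using (Fin)
open import Data.Fin.Subset using (Subset; _∈_; _∉_; _∪_; _-_; ⁅_⁆)
open import Data.Product using (Σ; ∃; _×_)
open import Relation.Nullary using (Dec)

infixl 5 _+ₛ_
_+ₛ_ : ∀ {n} → Subset n → Fin n → Subset n
X +ₛ x = X ∪ ⁅ x ⁆

-- Being a base is decidable (automatic classically for a finite matroid).
record Matroid (n : ℕ) : Set₁ where
  field
    IsBase    : Subset n → Set
    isBase?   : (X : Subset n) → Dec (IsBase X)
    base-exists : ∃ λ B → IsBase B
    exchange  : ∀ B₁ B₂ → IsBase B₁ → IsBase B₂ →
                ∀ x → x ∈ B₁ → x ∉ B₂ →
                ∃ λ y → y ∈ B₂ × y ∉ B₁ × IsBase (B₁ - x +ₛ y)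

module Submission where

-- Brualdi's symmetric exchange property is first derived from the basis exchange axiom. For A₁ = {x, y}
-- take a symmetric partner b of x, a symmetric partner c of y for (A - x + b, B) and a symmetric
-- partner d of y for (A, B - b + x). Then A - {x,y} + {b,c} and B - {b,d} + {x,y} are bases, so
-- (x y, b c) or (x y, b d) is a serial exchange unless both B - {b,c} + {x,y} and A - {x,y} + {b,d}
-- fail; in that case three further basis exchanges show that {c, d} works, with x or y exchanged first.

open import Defs
open import Data.Nat using (ℕ; suc; _<_)
open import Data.Nat.Induction using (<-wellFounded)
open import Data.Nat.Properties using (suc-injective)
open import Data.Fin using (Fin; zero; suc)
open import Data.Fin.Properties using (any?; _≟_) renaming (suc-injective to fin-suc-injective)
open import Data.Fin.Subset using (Subset; _⊆_; _∩_; _∪_; _─_; _-_; ⁅_⁆; ∣_∣; ⊥; _∈_; _∉_; inside; outside)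
open import Data.Fin.Subset.Properties
  using (_∈?_; ⊆-antisym; p⊂q⇒∣p∣<∣q∣; x∈p∪q⁺; x∈p∪q⁻; x∈p∩q⁺; ∉⊥; x∈⁅x⁆; x∈⁅y⁆⇒x≡y; x∉⁅y⁆⇒x≢y;
         x∈p∧x∉q⇒x∈p─q; x∈p∧x≢y⇒x∈p-y; p─q⊆p; ∪-comm; ∪-identityˡ; ∪-identityʳ; ∣⁅x⁆∣≡1)
open import Data.Vec using ([]; _∷_; here; there)
open import Data.Product using (∃; ∃₂; ∃-syntax; _×_; _,_)
open import Data.Sum using (_⊎_; inj₁; inj₂)
open import Data.Empty using (⊥-elim)
open import Function using (_∘_)
open import Induction.WellFounded using (Acc; acc)
open import Relation.Nullary using (¬_; yes; no)
open import Relation.Nullary.Decidable using (_×-dec_; ¬?)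
open import Relation.Binary.PropositionalEquality using (_≡_; _≢_; refl; sym; trans; cong; subst; module ≡-Reasoning)

private variable
  n : ℕ
  X Y C : Subset n
  x y p q r s t p₁ p₂ q₁ q₂ : Fin n

x∈p─q⇒x∉q : ∀ (P Q : Subset n) → x ∈ P ─ Q → x ∉ Q
x∈p─q⇒x∉q (inside ∷ P) (outside ∷ Q) here ()
x∈p─q⇒x∉q (_ ∷ P) (_ ∷ Q) (there x∈P─Q) (there x∈Q) = x∈p─q⇒x∉q P Q x∈P─Q x∈Q

swap : Subset n → Fin n → Fin n → Subset n
swap X p q = X - p +ₛ q

swap₂ : Subset n → Fin n → Fin n → Fin n → Fin n → Subset n
swap₂ X p₁ p₂ q₁ q₂ = (X ─ (⁅ p₁ ⁆ ∪ ⁅ p₂ ⁆)) ∪ (⁅ q₁ ⁆ ∪ ⁅ q₂ ⁆)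

∈-swap⁻ : x ∈ swap X p q → x ≡ q ⊎ (x ∈ X × x ≢ p)
∈-swap⁻ {X = X} {p} {q} x∈ with x∈p∪q⁻ (X - p) ⁅ q ⁆ x∈
... | inj₁ x∈X-p = inj₂ (p─q⊆p X ⁅ p ⁆ x∈X-p , x∉⁅y⁆⇒x≢y (x∈p─q⇒x∉q X ⁅ p ⁆ x∈X-p))
... | inj₂ x∈⁅q⁆ = inj₁ (x∈⁅y⁆⇒x≡y q x∈⁅q⁆)

∈-swap⁺ : x ≡ q ⊎ (x ∈ X × x ≢ p) → x ∈ swap X p q
∈-swap⁺ (inj₁ refl) = x∈p∪q⁺ (inj₂ (x∈⁅x⁆ _))
∈-swap⁺ (inj₂ (x∈X , x≢p)) = x∈p∪q⁺ (inj₁ (x∈p∧x≢y⇒x∈p-y x∈X x≢p))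

removed∉swap : p ≢ q → p ∉ swap X p q
removed∉swap p≢q p∈ with ∈-swap⁻ p∈
... | inj₁ p≡q = p≢q p≡q
... | inj₂ (_ , p≢p) = p≢p refl

⁅x⁆∪⁅y⁆⊆ : x ∈ X → y ∈ X → ⁅ x ⁆ ∪ ⁅ y ⁆ ⊆ X
⁅x⁆∪⁅y⁆⊆ {x = x} {y = y} x∈X y∈X z∈ with x∈p∪q⁻ ⁅ x ⁆ ⁅ y ⁆ z∈
... | inj₁ z∈⁅x⁆ = subst (_∈ _) (sym (x∈⁅y⁆⇒x≡y x z∈⁅x⁆)) x∈X
... | inj₂ z∈⁅y⁆ = subst (_∈ _) (sym (x∈⁅y⁆⇒x≡y y z∈⁅y⁆)) y∈X

∈-swap₂⁻ : x ∈ swap₂ X p₁ p₂ q₁ q₂ → x ≡ q₁ ⊎ x ≡ q₂ ⊎ (x ∈ X × x ≢ p₁ × x ≢ p₂)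
∈-swap₂⁻ {X = X} {p₁} {p₂} {q₁} {q₂} x∈ with x∈p∪q⁻ (X ─ (⁅ p₁ ⁆ ∪ ⁅ p₂ ⁆)) (⁅ q₁ ⁆ ∪ ⁅ q₂ ⁆) x∈
... | inj₁ x∈X─P = inj₂ (inj₂ (p─q⊆p X _ x∈X─P , (λ { refl → x∉P (x∈p∪q⁺ (inj₁ (x∈⁅x⁆ _))) })
                                                , (λ { refl → x∉P (x∈p∪q⁺ (inj₂ (x∈⁅x⁆ _))) })))
  where x∉P = x∈p─q⇒x∉q X _ x∈X─P
... | inj₂ x∈Q with x∈p∪q⁻ ⁅ q₁ ⁆ ⁅ q₂ ⁆ x∈Q
...   | inj₁ x∈⁅q₁⁆ = inj₁ (x∈⁅y⁆⇒x≡y q₁ x∈⁅q₁⁆)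
...   | inj₂ x∈⁅q₂⁆ = inj₂ (inj₁ (x∈⁅y⁆⇒x≡y q₂ x∈⁅q₂⁆))

∈-swap₂⁺ : x ≡ q₁ ⊎ x ≡ q₂ ⊎ (x ∈ X × x ≢ p₁ × x ≢ p₂) → x ∈ swap₂ X p₁ p₂ q₁ q₂
∈-swap₂⁺ (inj₁ refl) = x∈p∪q⁺ (inj₂ (x∈p∪q⁺ (inj₁ (x∈⁅x⁆ _))))
∈-swap₂⁺ (inj₂ (inj₁ refl)) = x∈p∪q⁺ (inj₂ (x∈p∪q⁺ (inj₂ (x∈⁅x⁆ _))))
∈-swap₂⁺ {p₁ = p₁} {p₂} (inj₂ (inj₂ (x∈X , x≢p₁ , x≢p₂))) = x∈p∪q⁺ (inj₁ (x∈p∧x∉q⇒x∈p─q x∈X x∉P))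
  where
  x∉P : _ ∉ ⁅ p₁ ⁆ ∪ ⁅ p₂ ⁆
  x∉P x∈P with x∈p∪q⁻ ⁅ p₁ ⁆ ⁅ p₂ ⁆ x∈P
  ... | inj₁ x∈⁅p₁⁆ = x≢p₁ (x∈⁅y⁆⇒x≡y p₁ x∈⁅p₁⁆)
  ... | inj₂ x∈⁅p₂⁆ = x≢p₂ (x∈⁅y⁆⇒x≡y p₂ x∈⁅p₂⁆)

swap-swap≡swap₂ : q ≢ r → swap (swap X p q) r s ≡ swap₂ X p r q s
swap-swap≡swap₂ {q = q} {r} {X} {p} {s} q≢r = ⊆-antisym l⊆r r⊆l
  where
  l⊆r : swap (swap X p q) r s ⊆ swap₂ X p r q s
  l⊆r x∈ with ∈-swap⁻ x∈
  ... | inj₁ refl = ∈-swap₂⁺ (inj₂ (inj₁ refl))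
  ... | inj₂ (x∈swap , x≢r) with ∈-swap⁻ x∈swap
  ...   | inj₁ refl = ∈-swap₂⁺ (inj₁ refl)
  ...   | inj₂ (x∈X , x≢p) = ∈-swap₂⁺ (inj₂ (inj₂ (x∈X , x≢p , x≢r)))
  r⊆l : swap₂ X p r q s ⊆ swap (swap X p q) r s
  r⊆l x∈ with ∈-swap₂⁻ x∈
  ... | inj₁ refl = ∈-swap⁺ (inj₂ (∈-swap⁺ (inj₁ refl) , q≢r))
  ... | inj₂ (inj₁ refl) = ∈-swap⁺ (inj₁ refl)
  ... | inj₂ (inj₂ (x∈X , x≢p , x≢r)) = ∈-swap⁺ (inj₂ (∈-swap⁺ (inj₂ (x∈X , x≢p)) , x≢r))

swap-restore : p ∈ X → p ≢ t → t ≢ q → swap (swap X p q) t p ≡ swap X t q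
swap-restore {p = p} {X} {t} {q} p∈X p≢t t≢q = ⊆-antisym l⊆r r⊆l
  where
  l⊆r : swap (swap X p q) t p ⊆ swap X t q
  l⊆r x∈ with ∈-swap⁻ x∈
  ... | inj₁ refl = ∈-swap⁺ (inj₂ (p∈X , p≢t))
  ... | inj₂ (x∈swap , x≢t) with ∈-swap⁻ x∈swap
  ...   | inj₁ refl = ∈-swap⁺ (inj₁ refl)
  ...   | inj₂ (x∈X , _) = ∈-swap⁺ (inj₂ (x∈X , x≢t))
  r⊆l : swap X t q ⊆ swap (swap X p q) t p
  r⊆l {x} x∈ with ∈-swap⁻ x∈
  ... | inj₁ refl = ∈-swap⁺ (inj₂ (∈-swap⁺ (inj₁ refl) , t≢q ∘ sym))
  ... | inj₂ (x∈X , x≢t) with x ≟ p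
  ...   | yes refl = ∈-swap⁺ (inj₁ refl)
  ...   | no x≢p = ∈-swap⁺ (inj₂ (∈-swap⁺ (inj₂ (x∈X , x≢p)) , x≢t))

swap-undo : p ∈ X → q ∉ X → swap (swap X p q) q p ≡ X
swap-undo {p = p} {X} {q} p∈X q∉X = ⊆-antisym l⊆r r⊆l
  where
  l⊆r : swap (swap X p q) q p ⊆ X
  l⊆r x∈ with ∈-swap⁻ x∈
  ... | inj₁ refl = p∈X
  ... | inj₂ (x∈swap , x≢q) with ∈-swap⁻ x∈swap
  ...   | inj₁ x≡q = ⊥-elim (x≢q x≡q)
  ...   | inj₂ (x∈X , _) = x∈X
  r⊆l : X ⊆ swap (swap X p q) q p
  r⊆l {x} x∈X with x ≟ p
  ... | yes refl = ∈-swap⁺ (inj₁ refl)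
  ... | no x≢p = ∈-swap⁺ (inj₂ (∈-swap⁺ (inj₂ (x∈X , x≢p)) , λ { refl → q∉X x∈X }))

swap₂-comm-out : ∀ X (p₁ p₂ q₁ q₂ : Fin n) → swap₂ X p₁ p₂ q₁ q₂ ≡ swap₂ X p₂ p₁ q₁ q₂
swap₂-comm-out X p₁ p₂ q₁ q₂ = cong (λ P → (X ─ P) ∪ (⁅ q₁ ⁆ ∪ ⁅ q₂ ⁆)) (∪-comm ⁅ p₁ ⁆ ⁅ p₂ ⁆)

swap₂-comm-in : ∀ X (p₁ p₂ q₁ q₂ : Fin n) → swap₂ X p₁ p₂ q₁ q₂ ≡ swap₂ X p₁ p₂ q₂ q₁
swap₂-comm-in X p₁ p₂ q₁ q₂ = cong ((X ─ (⁅ p₁ ⁆ ∪ ⁅ p₂ ⁆)) ∪_) (∪-comm ⁅ q₁ ⁆ ⁅ q₂ ⁆)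

swap₂≡swap-swap : s ≢ p → swap₂ X p r q s ≡ swap (swap X r s) p q
swap₂≡swap-swap {s = s} {p} {X} {r} {q} s≢p = begin
  swap₂ X p r q s           ≡⟨ swap₂-comm-out X p r q s ⟩
  swap₂ X r p q s           ≡⟨ swap₂-comm-in X r p q s ⟩
  swap₂ X r p s q           ≡⟨ swap-swap≡swap₂ s≢p ⟨
  swap (swap X r s) p q     ∎
  where open ≡-Reasoning

swap₂-restore : p ∈ X → p ≢ r → p ≢ t → t ≢ q → t ≢ s → s ≢ p →
                swap (swap₂ X p r q s) t p ≡ swap₂ X t r q s
swap₂-restore {p = p} {X} {r} {t} {q} {s} p∈X p≢r p≢t t≢q t≢s s≢p = begin
  swap (swap₂ X p r q s) t p           ≡⟨ cong (λ Y → swap Y t p) (swap₂≡swap-swap s≢p) ⟩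
  swap (swap (swap X r s) p q) t p     ≡⟨ swap-restore (∈-swap⁺ (inj₂ (p∈X , p≢r))) p≢t t≢q ⟩
  swap (swap X r s) t q                ≡⟨ swap₂≡swap-swap (t≢s ∘ sym) ⟨
  swap₂ X t r q s                      ∎
  where open ≡-Reasoning

swap₂-undo : p ∈ X → p ≢ r → q ∉ X → q ≢ s → s ≢ p → swap (swap₂ X p r q s) q p ≡ swap X r s
swap₂-undo {p = p} {X} {r} {q} {s} p∈X p≢r q∉X q≢s s≢p = begin
  swap (swap₂ X p r q s) q p           ≡⟨ cong (λ Y → swap Y q p) (swap₂≡swap-swap s≢p) ⟩
  swap (swap (swap X r s) p q) q p     ≡⟨ swap-undo (∈-swap⁺ (inj₂ (p∈X , p≢r))) q∉swap ⟩
  swap X r s                           ∎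
  where
  open ≡-Reasoning
  q∉swap : q ∉ swap X r s
  q∉swap q∈ with ∈-swap⁻ q∈
  ... | inj₁ q≡s = q≢s q≡s
  ... | inj₂ (q∈X , _) = q∉X q∈X

∣swap─∣<∣─∣ : p ∈ X → p ∉ C → q ∈ C → ∣ swap X p q ─ C ∣ < ∣ X ─ C ∣
∣swap─∣<∣─∣ {p = p} {X} {C} {q} p∈X p∉C q∈C =
  p⊂q⇒∣p∣<∣q∣ (swap─C⊆X─C , p , x∈p∧x∉q⇒x∈p─q p∈X p∉C , removed∉swap p≢q ∘ p─q⊆p _ C)
  where
  swap─C⊆X─C : swap X p q ─ C ⊆ X ─ C
  swap─C⊆X─C x∈ with ∈-swap⁻ (p─q⊆p _ C x∈)
  ... | inj₁ refl = ⊥-elim (x∈p─q⇒x∉q _ C x∈ q∈C)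
  ... | inj₂ (x∈X , _) = x∈p∧x∉q⇒x∈p─q x∈X (x∈p─q⇒x∉q _ C x∈)
  p≢q : p ≢ q
  p≢q refl = p∉C q∈C

∣p∣≡0⇒p≡⊥ : ∀ (P : Subset n) → ∣ P ∣ ≡ 0 → P ≡ ⊥
∣p∣≡0⇒p≡⊥ [] _ = refl
∣p∣≡0⇒p≡⊥ (outside ∷ P) ∣P∣≡0 = cong (outside ∷_) (∣p∣≡0⇒p≡⊥ P ∣P∣≡0)

∣p∣≡1⇒p≡⁅x⁆ : ∀ (P : Subset n) → ∣ P ∣ ≡ 1 → ∃[ x ] P ≡ ⁅ x ⁆
∣p∣≡1⇒p≡⁅x⁆ (inside ∷ P) ∣P∣≡1 = zero , cong (inside ∷_) (∣p∣≡0⇒p≡⊥ P (suc-injective ∣P∣≡1))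
∣p∣≡1⇒p≡⁅x⁆ (outside ∷ P) ∣P∣≡1 with ∣p∣≡1⇒p≡⁅x⁆ P ∣P∣≡1
... | x , refl = suc x , refl

∣p∣≡2⇒p≡⁅x⁆∪⁅y⁆ : ∀ (P : Subset n) → ∣ P ∣ ≡ 2 → ∃₂ λ x y → x ≢ y × P ≡ ⁅ x ⁆ ∪ ⁅ y ⁆
∣p∣≡2⇒p≡⁅x⁆∪⁅y⁆ (inside ∷ P) ∣P∣≡2 with ∣p∣≡1⇒p≡⁅x⁆ P (suc-injective ∣P∣≡2)
... | y , refl = zero , suc y , (λ ()) , cong (inside ∷_) (sym (∪-identityˡ ⁅ y ⁆))
∣p∣≡2⇒p≡⁅x⁆∪⁅y⁆ (outside ∷ P) ∣P∣≡2 with ∣p∣≡2⇒p≡⁅x⁆∪⁅y⁆ P ∣P∣≡2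
... | x , y , x≢y , refl = suc x , suc y , x≢y ∘ fin-suc-injective , refl

∣⁅x⁆∪⁅y⁆∣≡2 : x ≢ y → ∣ ⁅ x ⁆ ∪ ⁅ y ⁆ ∣ ≡ 2
∣⁅x⁆∪⁅y⁆∣≡2 {x = zero} {zero} x≢y = ⊥-elim (x≢y refl)
∣⁅x⁆∪⁅y⁆∣≡2 {x = zero} {suc y} _ = cong suc (trans (cong ∣_∣ (∪-identityˡ ⁅ y ⁆)) (∣⁅x⁆∣≡1 y))
∣⁅x⁆∪⁅y⁆∣≡2 {x = suc x} {zero} _ = cong suc (trans (cong ∣_∣ (∪-identityʳ ⁅ x ⁆)) (∣⁅x⁆∣≡1 x))
∣⁅x⁆∪⁅y⁆∣≡2 {x = suc x} {suc y} x≢y = ∣⁅x⁆∪⁅y⁆∣≡2 (x≢y ∘ cong suc)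

module _ (M : Matroid n) where
  open Matroid M

  base⊆base⇒≡ : IsBase X → IsBase Y → X ⊆ Y → X ≡ Y
  base⊆base⇒≡ {X} {Y} hX hY X⊆Y = ⊆-antisym X⊆Y Y⊆X
    where
    Y⊆X : Y ⊆ X
    Y⊆X {y} y∈Y with y ∈? X
    ... | yes y∈X = y∈X
    ... | no y∉X with exchange Y X hY hX y y∈Y y∉X
    ...   | z , z∈X , z∉Y , _ = ⊥-elim (z∉Y (X⊆Y z∈X))

  -- {b ∈ B | B - b + a is a base} ∪ {a} is the fundamental circuit of a in B, which no base contains.
  circuit⊈base : ∀ {B a} → IsBase B → a ∉ B → ∀ {Bs} → IsBase Bs → a ∈ Bs →
                 ∃[ b ] b ∈ B × IsBase (swap B b a) × b ∉ Bs
  circuit⊈base {B} {a} hB a∉B = go (<-wellFounded _)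
    where
    go : ∀ {Bs} → Acc _<_ ∣ Bs ─ B ∣ → IsBase Bs → a ∈ Bs → ∃[ b ] b ∈ B × IsBase (swap B b a) × b ∉ Bs
    go {Bs} (acc smaller) hBs a∈Bs with any? (λ e → e ∈? Bs ×-dec ¬? (e ∈? B) ×-dec ¬? (e ≟ a))
    ... | yes (e , e∈Bs , e∉B , e≢a) with exchange Bs B hBs hB e e∈Bs e∉B
    ...   | f , f∈B , _ , hBs′ with go (smaller (∣swap─∣<∣─∣ e∈Bs e∉B f∈B)) hBs′ (∈-swap⁺ (inj₂ (a∈Bs , e≢a ∘ sym)))
    ...     | b , b∈B , hb , b∉Bs′ = b , b∈B , hb , λ b∈Bs → b∉Bs′ (∈-swap⁺ (inj₂ (b∈Bs , λ { refl → e∉B b∈B })))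
    go {Bs} _ hBs a∈Bs | no ∄e with exchange Bs B hBs hB a a∈Bs a∉B
    ... | f , f∈B , f∉Bs , hBs′ = f , f∈B , subst IsBase Bs≡swap hBs , f∉Bs
      where
      swap⊆B : swap Bs a f ⊆ B
      swap⊆B x∈ with ∈-swap⁻ x∈
      ... | inj₁ refl = f∈B
      ... | inj₂ (x∈Bs , x≢a) with _ ∈? B
      ...   | yes x∈B = x∈B
      ...   | no x∉B = ⊥-elim (∄e (_ , x∈Bs , x∉B , x≢a))
      Bs≡swap : Bs ≡ swap B f a
      Bs≡swap = begin
        Bs                          ≡⟨ swap-undo a∈Bs f∉Bs ⟨
        swap (swap Bs a f) f a      ≡⟨ cong (λ Y → swap Y f a) (base⊆base⇒≡ hBs′ hB swap⊆B) ⟩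
        swap B f a                  ∎
        where open ≡-Reasoning

  SymmetricExchange : Subset n → Subset n → Fin n → Fin n → Set
  SymmetricExchange A B a b = b ∈ B × b ∉ A × IsBase (swap A a b) × IsBase (swap B b a)

  -- Every base either misses an element of the fundamental circuit of a in B or yields a symmetric
  -- partner of a (induction on |Bs ─ A|: exchange an element g ∉ A of Bs towards A, and if the circuit
  -- element missed by the new base is g itself, g is the partner). B contains that circuit.
  symmetric-exchange : ∀ {A B a} → IsBase A → IsBase B → a ∈ A → a ∉ B → ∃[ b ] SymmetricExchange A B a b
  symmetric-exchange {A} {B} {a} hA hB a∈A a∉B with go (<-wellFounded _) hB
    where
    go : ∀ {Bs} → Acc _<_ ∣ Bs ─ A ∣ → IsBase Bs →
         (∃[ b ] SymmetricExchange A B a b) ⊎ (∃[ b ] b ∈ B × IsBase (swap B b a) × b ∉ Bs)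
    go {Bs} (acc smaller) hBs with a ∈? Bs
    ... | yes a∈Bs = inj₂ (circuit⊈base hB a∉B hBs a∈Bs)
    ... | no a∉Bs with exchange A Bs hA hBs a a∈A a∉Bs
    ...   | g , g∈Bs , g∉A , hAg with exchange Bs A hBs hA g g∈Bs g∉A
    ...     | f , f∈A , _ , hBs′ with go (smaller (∣swap─∣<∣─∣ g∈Bs g∉A f∈A)) hBs′
    ...       | inj₁ partner = inj₁ partner
    ...       | inj₂ (b , b∈B , hb , b∉Bs′) with b ≟ g
    ...         | yes refl = inj₁ (b , b∈B , g∉A , hAg , hb)
    ...         | no b≢g = inj₂ (b , b∈B , hb , λ b∈Bs → b∉Bs′ (∈-swap⁺ (inj₂ (b∈Bs , b≢g))))
  ... | inj₁ partner = partner
  ... | inj₂ (_ , b∈B , _ , b∉B) = ⊥-elim (b∉B b∈B)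

  SerialExchange₂ : Subset n → Subset n → Fin n → Fin n → Fin n → Fin n → Set
  SerialExchange₂ A B a₁ a₂ b₁ b₂ =
    IsBase (swap A a₁ b₁) × IsBase (swap B b₁ a₁) × IsBase (swap₂ A a₁ a₂ b₁ b₂) × IsBase (swap₂ B b₁ b₂ a₁ a₂)

  SerialExchangePartner : Subset n → Subset n → Fin n → Fin n → Set
  SerialExchangePartner A B a₁ a₂ = ∃₂ λ b₁ b₂ → b₁ ∈ B × b₂ ∈ B × b₁ ≢ b₂ ×
    (SerialExchange₂ A B a₁ a₂ b₁ b₂ ⊎ SerialExchange₂ A B a₂ a₁ b₁ b₂)

  private
    module PairExchange {A B} (hA : IsBase A) (hB : IsBase B) (disjoint : ∀ {i} → i ∈ A → i ∉ B)
                        {x y} (x∈A : x ∈ A) (y∈A : y ∈ A) (x≢y : x ≢ y) where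

      ≢ᴬᴮ : ∀ {i j} → i ∈ A → j ∈ B → i ≢ j
      ≢ᴬᴮ i∈A j∈B refl = disjoint i∈A j∈B

      ≢ᴮᴬ : ∀ {i j} → i ∈ B → j ∈ A → i ≢ j
      ≢ᴮᴬ i∈B j∈A refl = disjoint j∈A i∈B

      module _ {b c d} (b∈B : b ∈ B) (c∈B : c ∈ B) (d∈B : d ∈ B) (c≢b : c ≢ b) (d≢b : d ≢ b)
               (Axb : IsBase (swap A x b)) (Bbx : IsBase (swap B b x))
               (Abc : IsBase (swap₂ A x y b c)) (Bcy : IsBase (swap B c y))
               (Ayd : IsBase (swap A y d)) (Bbd : IsBase (swap₂ B b d x y)) where

        Bcd : ¬ IsBase (swap₂ B b c x y) → c ≢ d → IsBase (swap₂ B c d x y)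
        Bcd ¬Bbc c≢d with exchange (swap₂ B b d x y) (swap B c y) Bbd Bcy c
                            (∈-swap₂⁺ (inj₂ (inj₂ (c∈B , c≢b , c≢d)))) (removed∉swap (≢ᴮᴬ c∈B y∈A))
        ... | e , e∈ , e∉Bbd , hBe with ∈-swap⁻ e∈
        ...   | inj₁ refl = ⊥-elim (e∉Bbd (∈-swap₂⁺ (inj₂ (inj₁ refl))))
        ...   | inj₂ (e∈B , _) with e ≟ b | e ≟ d
        ...     | yes refl | _ =
          subst IsBase (swap₂-restore e∈B (d≢b ∘ sym) (c≢b ∘ sym) (≢ᴮᴬ c∈B x∈A) (≢ᴮᴬ c∈B y∈A) (≢ᴬᴮ y∈A e∈B)) hBe
        ...     | no _ | yes refl = ⊥-elim (¬Bbc (subst IsBase Bbd-c+d≡Bbc hBe))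
          where
          Bbd-c+d≡Bbc : swap (swap₂ B b e x y) c e ≡ swap₂ B b c x y
          Bbd-c+d≡Bbc = begin
            swap (swap₂ B b e x y) c e   ≡⟨ cong (λ Y → swap Y c e) (swap₂-comm-out B b e x y) ⟩
            swap (swap₂ B e b x y) c e   ≡⟨ swap₂-restore e∈B d≢b (c≢d ∘ sym) (≢ᴮᴬ c∈B x∈A) (≢ᴮᴬ c∈B y∈A) (≢ᴬᴮ y∈A e∈B) ⟩
            swap₂ B c b x y              ≡⟨ swap₂-comm-out B c b x y ⟩
            swap₂ B b c x y              ∎
            where open ≡-Reasoning
        ...     | no e≢b | no e≢d = ⊥-elim (e∉Bbd (∈-swap₂⁺ (inj₂ (inj₂ (e∈B , e≢b , e≢d)))))

        ¬Abd⇒c≢d : ¬ IsBase (swap₂ A x y b d) → c ≢ d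
        ¬Abd⇒c≢d ¬Abd refl = ¬Abd Abc

        Ayd-x+e≡swap₂ : ∀ e → swap (swap A y d) x e ≡ swap₂ A x y e d
        Ayd-x+e≡swap₂ e = begin
          swap (swap A y d) x e   ≡⟨ swap-swap≡swap₂ (≢ᴮᴬ d∈B x∈A) ⟩
          swap₂ A y x d e         ≡⟨ swap₂-comm-out A y x d e ⟩
          swap₂ A x y d e         ≡⟨ swap₂-comm-in A x y d e ⟩
          swap₂ A x y e d         ∎
          where open ≡-Reasoning

        x∉Abc : x ∉ swap₂ A x y b c
        x∉Abc x∈ with ∈-swap₂⁻ x∈
        ... | inj₁ refl = disjoint x∈A b∈B
        ... | inj₂ (inj₁ refl) = disjoint x∈A c∈B
        ... | inj₂ (inj₂ (_ , x≢x , _)) = x≢x refl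

        Acd : ¬ IsBase (swap₂ A x y b d) → IsBase (swap₂ A x y c d)
        Acd ¬Abd with exchange (swap A y d) (swap₂ A x y b c) Ayd Abc x (∈-swap⁺ (inj₂ (x∈A , x≢y))) x∉Abc
        ... | e , e∈Abc , e∉Ayd , hAe with ∈-swap₂⁻ e∈Abc
        ...   | inj₁ refl = ⊥-elim (¬Abd (subst IsBase (Ayd-x+e≡swap₂ e) hAe))
        ...   | inj₂ (inj₁ refl) = subst IsBase (Ayd-x+e≡swap₂ e) hAe
        ...   | inj₂ (inj₂ (e∈A , _ , e≢y)) = ⊥-elim (e∉Ayd (∈-swap⁺ (inj₂ (e∈A , e≢y))))

        Ayc⊎Axc : IsBase (swap A y c) ⊎ IsBase (swap A x c)
        Ayc⊎Axc with exchange (swap₂ A x y b c) A Abc hA b (∈-swap₂⁺ (inj₁ refl)) (λ b∈A → disjoint b∈A b∈B)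
        ... | e , e∈A , e∉Abc , hAe with e ≟ x | e ≟ y
        ...   | yes refl | _ =
          inj₁ (subst IsBase (swap₂-undo x∈A x≢y (λ b∈A → disjoint b∈A b∈B) (c≢b ∘ sym) (≢ᴮᴬ c∈B x∈A)) hAe)
        ...   | no _ | yes refl = inj₂ (subst IsBase Abc-b+y≡Axc hAe)
          where
          Abc-b+y≡Axc : swap (swap₂ A x e b c) b e ≡ swap A x c
          Abc-b+y≡Axc = begin
            swap (swap₂ A x e b c) b e   ≡⟨ cong (λ Y → swap Y b e) (swap₂-comm-out A x e b c) ⟩
            swap (swap₂ A e x b c) b e   ≡⟨ swap₂-undo e∈A (x≢y ∘ sym) (λ b∈A → disjoint b∈A b∈B) (c≢b ∘ sym) (≢ᴮᴬ c∈B e∈A) ⟩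
            swap A x c                   ∎
            where open ≡-Reasoning
        ...   | no e≢x | no e≢y = ⊥-elim (e∉Abc (∈-swap₂⁺ (inj₂ (inj₂ (e∈A , e≢x , e≢y)))))

        Bcx : ¬ IsBase (swap₂ B b c x y) → IsBase (swap B c x)
        Bcx ¬Bbc with exchange (swap B b x) (swap B c y) Bbx Bcy c (∈-swap⁺ (inj₂ (c∈B , c≢b))) (removed∉swap (≢ᴮᴬ c∈B y∈A))
        ... | g , g∈Bcy , g∉Bbx , hBg with ∈-swap⁻ g∈Bcy
        ...   | inj₁ refl = ⊥-elim (¬Bbc (subst IsBase (swap-swap≡swap₂ (≢ᴬᴮ x∈A c∈B)) hBg))
        ...   | inj₂ (g∈B , _) with g ≟ b
        ...     | yes refl = subst IsBase (swap-restore g∈B (c≢b ∘ sym) (≢ᴮᴬ c∈B x∈A)) hBg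
        ...     | no g≢b = ⊥-elim (g∉Bbx (∈-swap⁺ (inj₂ (g∈B , g≢b))))

        partner : SerialExchangePartner A B x y
        partner with isBase? (swap₂ B b c x y)
        ... | yes Bbc = b , c , b∈B , c∈B , c≢b ∘ sym , inj₁ (Axb , Bbx , Abc , Bbc)
        ... | no ¬Bbc with isBase? (swap₂ A x y b d)
        ...   | yes Abd = b , d , b∈B , d∈B , d≢b ∘ sym , inj₁ (Axb , Bbx , Abd , Bbd)
        ...   | no ¬Abd with Ayc⊎Axc
        ...     | inj₁ Ayc = c , d , c∈B , d∈B , ¬Abd⇒c≢d ¬Abd ,
                    inj₂ (Ayc , Bcy , subst IsBase (swap₂-comm-out A x y c d) (Acd ¬Abd) ,
                                      subst IsBase (swap₂-comm-in B c d x y) (Bcd ¬Bbc (¬Abd⇒c≢d ¬Abd)))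
        ...     | inj₂ Axc = c , d , c∈B , d∈B , ¬Abd⇒c≢d ¬Abd ,
                    inj₁ (Axc , Bcx ¬Bbc , Acd ¬Abd , Bcd ¬Bbc (¬Abd⇒c≢d ¬Abd))

      y∉swap : ∀ {b} → y ∉ swap B b x
      y∉swap y∈ with ∈-swap⁻ y∈
      ... | inj₁ y≡x = x≢y (sym y≡x)
      ... | inj₂ (y∈B , _) = disjoint y∈A y∈B

      serial-exchange₂ : SerialExchangePartner A B x y
      serial-exchange₂ with symmetric-exchange hA hB x∈A (disjoint x∈A)
      ... | b , b∈B , _ , Axb , Bbx
        with symmetric-exchange Axb hB (∈-swap⁺ (inj₂ (y∈A , x≢y ∘ sym))) (disjoint y∈A)
           | symmetric-exchange hA Bbx y∈A y∉swap
      ... | c , c∈B , c∉Axb , Axb-y+c , Bcy | d , d∈Bbx , d∉A , Ayd , Bbx-d+y with ∈-swap⁻ d∈Bbx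
      ...   | inj₁ refl = ⊥-elim (d∉A x∈A)
      ...   | inj₂ (d∈B , d≢b) =
              partner b∈B c∈B d∈B (λ { refl → c∉Axb (∈-swap⁺ (inj₁ refl)) }) d≢b Axb Bbx
                      (subst IsBase (swap-swap≡swap₂ (≢ᴮᴬ b∈B y∈A)) Axb-y+c) Bcy
                      Ayd (subst IsBase (swap-swap≡swap₂ (≢ᴬᴮ x∈A d∈B)) Bbx-d+y)

  serial-exchange₂ : ∀ {A B x y} → IsBase A → IsBase B → (∀ {i} → i ∈ A → i ∉ B) →
                     x ∈ A → y ∈ A → x ≢ y → SerialExchangePartner A B x y
  serial-exchange₂ hA hB disjoint x∈A y∈A x≢y = PairExchange.serial-exchange₂ hA hB disjoint x∈A y∈A x≢y

  serial-exchange₂⇒subsets : ∀ {A B A₁ a₁ a₂ b₁ b₂} → A₁ ≡ ⁅ a₁ ⁆ ∪ ⁅ a₂ ⁆ →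
    b₁ ∈ B → b₂ ∈ B → b₁ ≢ b₂ → SerialExchange₂ A B a₁ a₂ b₁ b₂ →
    ∃ λ (B₁ : Subset n) → B₁ ⊆ B × ∣ B₁ ∣ ≡ 2 ×
      (∃ λ (a₁ : Fin n) → ∃ λ (a₂ : Fin n) → ∃ λ (b₁ : Fin n) → ∃ λ (b₂ : Fin n) →
        A₁ ≡ ⁅ a₁ ⁆ ∪ ⁅ a₂ ⁆ × B₁ ≡ ⁅ b₁ ⁆ ∪ ⁅ b₂ ⁆ ×
        IsBase (A - a₁ +ₛ b₁) × IsBase (B - b₁ +ₛ a₁) × IsBase ((A ─ A₁) ∪ B₁) × IsBase ((B ─ B₁) ∪ A₁))
  serial-exchange₂⇒subsets {a₁ = a₁} {a₂} {b₁} {b₂} refl b₁∈B b₂∈B b₁≢b₂ (h₁ , h₂ , h₃ , h₄) =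
    ⁅ b₁ ⁆ ∪ ⁅ b₂ ⁆ , ⁅x⁆∪⁅y⁆⊆ b₁∈B b₂∈B , ∣⁅x⁆∪⁅y⁆∣≡2 b₁≢b₂ , a₁ , a₂ , b₁ , b₂ , refl , refl , h₁ , h₂ , h₃ , h₄

theorem3p3 : ∀ {n} (M : Matroid n) (A B : Subset n) →
    Matroid.IsBase M A → Matroid.IsBase M B → A ∩ B ≡ ⊥ →
    ∀ (A₁ : Subset n) → A₁ ⊆ A → ∣ A₁ ∣ ≡ 2 →
    ∃ λ (B₁ : Subset n) → B₁ ⊆ B × ∣ B₁ ∣ ≡ 2 ×
      (∃ λ (a₁ : Fin n) → ∃ λ (a₂ : Fin n) → ∃ λ (b₁ : Fin n) → ∃ λ (b₂ : Fin n) →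
        A₁ ≡ ⁅ a₁ ⁆ ∪ ⁅ a₂ ⁆ × B₁ ≡ ⁅ b₁ ⁆ ∪ ⁅ b₂ ⁆ ×
        Matroid.IsBase M (A - a₁ +ₛ b₁) ×
        Matroid.IsBase M (B - b₁ +ₛ a₁) ×
        Matroid.IsBase M ((A ─ A₁) ∪ B₁) ×
        Matroid.IsBase M ((B ─ B₁) ∪ A₁))
theorem3p3 M A B hA hB A∩B≡⊥ A₁ A₁⊆A ∣A₁∣≡2 with ∣p∣≡2⇒p≡⁅x⁆∪⁅y⁆ A₁ ∣A₁∣≡2
... | x , y , x≢y , refl
  with serial-exchange₂ M hA hB disjoint (A₁⊆A (x∈p∪q⁺ (inj₁ (x∈⁅x⁆ x)))) (A₁⊆A (x∈p∪q⁺ (inj₂ (x∈⁅x⁆ y)))) x≢y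
  where
  disjoint : ∀ {i} → i ∈ A → i ∉ B
  disjoint i∈A i∈B = ∉⊥ (subst (_ ∈_) A∩B≡⊥ (x∈p∩q⁺ (i∈A , i∈B)))
... | b₁ , b₂ , b₁∈B , b₂∈B , b₁≢b₂ , inj₁ xy-exchange =
  serial-exchange₂⇒subsets M refl b₁∈B b₂∈B b₁≢b₂ xy-exchange
... | b₁ , b₂ , b₁∈B , b₂∈B , b₁≢b₂ , inj₂ yx-exchange =
  serial-exchange₂⇒subsets M (∪-comm ⁅ x ⁆ ⁅ y ⁆) b₁∈B b₂∈B b₁≢b₂ yx-exchange
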